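{- Let $k>1$ and let $f_1,\dots,f_k\in\mathbb{Z}[x]$ satisfy $\gcd(f_1,\dots,f_k)=1$. Then for almost every prime number $p$ there exist $c_1,\dots,c_k\in\mathbb{Z}$ such that the polynomial $c_1f_1+\dots+c_kf_k$ has no root in $\mathbb{F}_p$. -}

module Defs where

open import Data.Nat using (ℕ; zero; suc)
open import Data.Fin using (Fin; zero; suc)
open import Data.Integer using (ℤ; _+_; _*_; 0ℤ; 1ℤ)
open import Data.List using (List; []; _∷_; map)
open import Data.Product using (∃-syntax)
open import Relation.Binary.PropositionalEquality using (_≡_)

-- Polynomials in ℤ[x] as coefficient lists, constant term first.
Poly : Set
Poly = List ℤ

coeff : Poly → ℕ → ℤ
coeff []       _       = 0ℤ
coeff (a ∷ f)  zero    = a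
coeff (a ∷ f)  (suc n) = coeff f n

-- equality of polynomials (coefficientwise, so trailing zeros are irrelevant)
_≈ₚ_ : Poly → Poly → Set
f ≈ₚ g = ∀ n → coeff f n ≡ coeff g n

infix 4 _≈ₚ_ _∣ₚ_
infixl 6 _+ₚ_
infixl 7 _*ₚ_ _·ₚ_

_+ₚ_ : Poly → Poly → Poly
[]      +ₚ g       = g
(a ∷ f) +ₚ []      = a ∷ f
(a ∷ f) +ₚ (b ∷ g) = (a + b) ∷ (f +ₚ g)

_·ₚ_ : ℤ → Poly → Poly
c ·ₚ f = map (c *_) f

_*ₚ_ : Poly → Poly → Poly
[]      *ₚ g = []
(a ∷ f) *ₚ g = (a ·ₚ g) +ₚ (0ℤ ∷ (f *ₚ g))

eval : Poly → ℤ → ℤ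
eval []      x = 0ℤ
eval (a ∷ f) x = a + x * eval f x

_∣ₚ_ : Poly → Poly → Set
g ∣ₚ f = ∃[ h ] (g *ₚ h ≈ₚ f)

GcdOne : ∀ {k} → (Fin k → Poly) → Set
GcdOne f = ∀ g → (∀ i → g ∣ₚ f i) → g ∣ₚ (1ℤ ∷ [])

linComb : ∀ k → (Fin k → ℤ) → (Fin k → Poly) → Poly
linComb zero    c f = []
linComb (suc k) c f = (c zero ·ₚ f zero) +ₚ linComb k (λ i → c (suc i)) (λ i → f (suc i))

{-# OPTIONS --safe #-}
-- The Euclidean algorithm with pseudo-division produces a gcd G ∈ ℤ[x] of the fᵢ over ℚ lying in
-- the ideal (f₁, …, f_k) of ℤ[x], so p ∣ G(a) whenever p divides every fᵢ(a). By Gauss's lemma the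
-- primitive part of G divides every fᵢ in ℤ[x], hence is a unit since gcd(fᵢ) = 1; thus G u = d for
-- the content d ≠ 0 of G and some u ∈ ℤ[x], and for p > ∣d∣ the value vectors wₐ = (fᵢ(a))ᵢ,
-- a ∈ 𝔽_p, are nonzero mod p. A vector c with c · wₐ ≢ 0 for all a is then built one coordinate
-- at a time: two coordinates are merged into s w₀ + t w₁ for one of the p + 1 pairwise independent
-- pairs (s, t) = (0, 1), (1, 0), …, (1, p - 1), each wₐ excluding at most one of them.
module Submission where

open import Defs
open import Function using (_∘_)
open import Data.Empty using (⊥-elim)
open import Data.Unit using (⊤; tt)
open import Data.Product using (∃-syntax; ∃₂; _×_; _,_; proj₁; proj₂)
open import Data.Sum using (_⊎_; inj₁; inj₂; [_,_]′)
open import Data.Fin.Base using (Fin; zero; suc; toℕ; fromℕ<)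
import Data.Fin.Properties as Finₚ
open import Data.Nat.Base as ℕ using (ℕ; zero; suc; _<_; _≤_; z≤n; s≤s; _∸_; _⊓_)
import Data.Nat.Properties as ℕₚ
import Data.Nat.Divisibility as ℕᵈ
open import Data.Nat.ListAction using (product)
open import Data.Nat.Primality using (Prime; euclidsLemma; prime⇒nonZero; ¬prime[0]; ¬prime[1])
open import Data.Nat.Primality.Factorisation using (PrimeFactorisation; factorise)
open import Data.Integer.Base as ℤ using (ℤ; +_; -[1+_]; _+_; _*_; _-_; -_; 0ℤ; 1ℤ; ∣_∣; _^_)
open import Data.Integer.Properties
open import Data.Integer.DivMod using (_%ℕ_; _/ℕ_; n%ℕd<d; a≡a%ℕn+[a/ℕn]*n)
open import Data.Integer.Divisibility using (_∣_)
open import Data.Integer.Divisibility.Signed renaming (_∣_ to _∣ₛ_; _∣?_ to _∣ₛ?_)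
open import Data.Integer.GCD using (gcd; gcd[i,j]∣i; gcd[i,j]∣j; gcd-greatest)
open import Data.Integer.Tactic.RingSolver using (solve-∀)
open import Data.List.Base using (List; []; _∷_; _++_; [_]; length; replicate; reverse; zipWith)
open import Data.List.Properties using (length-++; length-replicate; length-zipWith; unfold-reverse; reverse-involutive)
open import Data.List.Relation.Unary.All using (All; []; _∷_)
open import Relation.Nullary using (¬_; Dec; yes; no)
open import Relation.Nullary.Decidable using (_→-dec_; _×-dec_; decidable-stable)
open import Relation.Binary.PropositionalEquality
  using (_≡_; _≢_; _≗_; refl; sym; trans; cong; cong₂; subst; subst₂; module ≡-Reasoning)

*-≢0 : ∀ {i j} → i ≢ 0ℤ → j ≢ 0ℤ → i * j ≢ 0ℤ
*-≢0 {i} i≢0 j≢0 ij≡0 with i*j≡0⇒i≡0∨j≡0 i ij≡0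
... | inj₁ i≡0 = i≢0 i≡0
... | inj₂ j≡0 = j≢0 j≡0

2*i≢1 : ∀ i → + 2 * i ≢ 1ℤ
2*i≢1 i 2i≡1 with ℕᵈ.∣1⇒≡1 (∣⇒∣ᵤ (divides i (sym (trans (*-comm i (+ 2)) 2i≡1))))
... | ()

∣n∣<d∧d∣n⇒n≡0 : ∀ {d n} → ∣ n ∣ < d → + d ∣ₛ n → n ≡ 0ℤ
∣n∣<d∧d∣n⇒n≡0 {d} {n} ∣n∣<d d∣n with ∣ n ∣ ℕₚ.≟ 0
... | yes ∣n∣≡0 = ∣i∣≡0⇒i≡0 ∣n∣≡0
... | no  ∣n∣≢0 = ⊥-elim (ℕᵈ.>⇒∤ ⦃ ℕ.≢-nonZero ∣n∣≢0 ⦄ ∣n∣<d (∣⇒∣ᵤ d∣n))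

euclidsLemmaℤ : ∀ {p} a b → Prime p → + p ∣ₛ a * b → + p ∣ₛ a ⊎ + p ∣ₛ b
euclidsLemmaℤ {p} a b p-prime p∣ab
  with euclidsLemma ∣ a ∣ ∣ b ∣ p-prime (subst (p ℕᵈ.∣_) (abs-* a b) (∣⇒∣ᵤ p∣ab))
... | inj₁ p∣a = inj₁ (∣ᵤ⇒∣ p∣a)
... | inj₂ p∣b = inj₂ (∣ᵤ⇒∣ p∣b)

-- Polynomial evaluation

coeff-+ₚ : ∀ f g n → coeff (f +ₚ g) n ≡ coeff f n + coeff g n
coeff-+ₚ []      g       n       = sym (+-identityˡ _)
coeff-+ₚ (a ∷ f) []      n       = sym (+-identityʳ _)
coeff-+ₚ (a ∷ f) (b ∷ g) zero    = refl
coeff-+ₚ (a ∷ f) (b ∷ g) (suc n) = coeff-+ₚ f g n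

coeff-·ₚ : ∀ c f n → coeff (c ·ₚ f) n ≡ c * coeff f n
coeff-·ₚ c []      n       = sym (*-zeroʳ c)
coeff-·ₚ c (a ∷ f) zero    = refl
coeff-·ₚ c (a ∷ f) (suc n) = coeff-·ₚ c f n

eval-+ₚ : ∀ f g x → eval (f +ₚ g) x ≡ eval f x + eval g x
eval-+ₚ []      g       x = sym (+-identityˡ _)
eval-+ₚ (a ∷ f) []      x = sym (+-identityʳ _)
eval-+ₚ (a ∷ f) (b ∷ g) x = begin
  a + b + x * eval (f +ₚ g) x         ≡⟨ cong (λ t → a + b + x * t) (eval-+ₚ f g x) ⟩
  a + b + x * (eval f x + eval g x)   ≡⟨ rearrange a b x (eval f x) (eval g x) ⟩
  a + x * eval f x + (b + x * eval g x) ∎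
  where
  open ≡-Reasoning
  rearrange : ∀ a b x u v → a + b + x * (u + v) ≡ a + x * u + (b + x * v)
  rearrange = solve-∀

eval-·ₚ : ∀ c f x → eval (c ·ₚ f) x ≡ c * eval f x
eval-·ₚ c []      x = sym (*-zeroʳ c)
eval-·ₚ c (a ∷ f) x = trans (cong (λ t → c * a + x * t) (eval-·ₚ c f x)) (rearrange c a x (eval f x))
  where
  rearrange : ∀ c a x u → c * a + x * (c * u) ≡ c * (a + x * u)
  rearrange = solve-∀

eval-*ₚ : ∀ f g x → eval (f *ₚ g) x ≡ eval f x * eval g x
eval-*ₚ []      g x = refl
eval-*ₚ (a ∷ f) g x = begin
  eval (a ·ₚ g +ₚ (0ℤ ∷ f *ₚ g)) x
    ≡⟨ eval-+ₚ (a ·ₚ g) (0ℤ ∷ f *ₚ g) x ⟩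
  eval (a ·ₚ g) x + (0ℤ + x * eval (f *ₚ g) x)
    ≡⟨ cong₂ (λ s t → s + (0ℤ + x * t)) (eval-·ₚ a g x) (eval-*ₚ f g x) ⟩
  a * eval g x + (0ℤ + x * (eval f x * eval g x))
    ≡⟨ rearrange a x (eval f x) (eval g x) ⟩
  (a + x * eval f x) * eval g x ∎
  where
  open ≡-Reasoning
  rearrange : ∀ a x u v → a * v + (0ℤ + x * (u * v)) ≡ (a + x * u) * v
  rearrange = solve-∀

eval-zero : ∀ f → (∀ n → coeff f n ≡ 0ℤ) → ∀ x → eval f x ≡ 0ℤ
eval-zero []      f≡0 x = refl
eval-zero (a ∷ f) f≡0 x = begin
  a + x * eval f x  ≡⟨ cong₂ (λ s t → s + x * t) (f≡0 zero) (eval-zero f (f≡0 ∘ suc) x) ⟩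
  0ℤ + x * 0ℤ       ≡⟨ cong (λ t → 0ℤ + t) (*-zeroʳ x) ⟩
  0ℤ                ∎
  where open ≡-Reasoning

eval-cong : ∀ {f g} → f ≈ₚ g → eval f ≗ eval g
eval-cong {[]}    {g}     f≈g x = sym (eval-zero g (sym ∘ f≈g) x)
eval-cong {a ∷ f} {[]}    f≈g x = eval-zero (a ∷ f) f≈g x
eval-cong {a ∷ f} {b ∷ g} f≈g x = cong₂ (λ s t → s + x * t) (f≈g zero) (eval-cong {f} {g} (f≈g ∘ suc) x)

x-y∣f[x]-f[y] : ∀ f x y → (x - y) ∣ₛ (eval f x - eval f y)
x-y∣f[x]-f[y] []      x y = divides 0ℤ refl
x-y∣f[x]-f[y] (a ∷ f) x y with x-y∣f[x]-f[y] f x y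
... | divides q eq = divides (x * q + eval f y) (begin
  a + x * eval f x - (a + y * eval f y)      ≡⟨ split a x y (eval f x) (eval f y) ⟩
  x * (eval f x - eval f y) + (x - y) * eval f y ≡⟨ cong (λ t → x * t + (x - y) * eval f y) eq ⟩
  x * (q * (x - y)) + (x - y) * eval f y     ≡⟨ factor x y q (eval f y) ⟩
  (x * q + eval f y) * (x - y)               ∎)
  where
  open ≡-Reasoning
  split : ∀ a x y u v → a + x * u - (a + y * v) ≡ x * (u - v) + (x - y) * v
  split = solve-∀
  factor : ∀ x y q v → x * (q * (x - y)) + (x - y) * v ≡ (x * q + v) * (x - y)
  factor = solve-∀

-- A polynomial vanishing on ℤ is zero: its constant term is f(0), and the cofactor g of
-- f = a + x g vanishes off 0, hence also at 0 because 1 + ∣g(0)∣ divides g(1 + ∣g(0)∣) - g(0).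
eval≡0⇒coeff≡0 : ∀ f → (∀ x → eval f x ≡ 0ℤ) → ∀ n → coeff f n ≡ 0ℤ
eval≡0⇒coeff≡0 []      f≡0 n       = refl
eval≡0⇒coeff≡0 (a ∷ g) f≡0 zero    = trans (sym (+-identityʳ a)) (f≡0 0ℤ)
eval≡0⇒coeff≡0 (a ∷ g) f≡0 (suc n) = eval≡0⇒coeff≡0 g g≡0 n
  where
  a≡0 : a ≡ 0ℤ
  a≡0 = eval≡0⇒coeff≡0 (a ∷ g) f≡0 zero
  xg≡0 : ∀ x → x * eval g x ≡ 0ℤ
  xg≡0 x = trans (sym (trans (cong (_+ x * eval g x) a≡0) (+-identityˡ _))) (f≡0 x)
  g≡0-off-0 : ∀ x → x ≢ 0ℤ → eval g x ≡ 0ℤ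
  g≡0-off-0 x x≢0 with i*j≡0⇒i≡0∨j≡0 x (xg≡0 x)
  ... | inj₁ x≡0  = ⊥-elim (x≢0 x≡0)
  ... | inj₂ gx≡0 = gx≡0
  g₀ = eval g 0ℤ
  y = + suc ∣ g₀ ∣
  y∣g₀ : y ∣ₛ g₀
  y∣g₀ = subst (y ∣ₛ_) (neg-involutive g₀) (∣m⇒∣-m (subst₂ _∣ₛ_ (+-identityʳ y)
           (trans (cong (_- g₀) (g≡0-off-0 y (λ ()))) (+-identityˡ _)) (x-y∣f[x]-f[y] g y 0ℤ)))
  g≡0 : ∀ x → eval g x ≡ 0ℤ
  g≡0 x with x ≟ 0ℤ
  ... | yes refl = ∣n∣<d∧d∣n⇒n≡0 (ℕₚ.n<1+n ∣ g₀ ∣) y∣g₀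
  ... | no  x≢0  = g≡0-off-0 x x≢0

eval-injective : ∀ f g → eval f ≗ eval g → f ≈ₚ g
eval-injective f g f≗g n = i-j≡0⇒i≡j _ _ (begin
  coeff f n - coeff g n
    ≡⟨ cong (λ t → coeff f n + t) (sym (trans (coeff-·ₚ (- 1ℤ) g n) (-1*i≡-i _))) ⟩
  coeff f n + coeff (- 1ℤ ·ₚ g) n ≡⟨ sym (coeff-+ₚ f _ n) ⟩
  coeff (f -ₚ g) n                ≡⟨ eval≡0⇒coeff≡0 (f -ₚ g) f-g≡0 n ⟩
  0ℤ                              ∎)
  where
  open ≡-Reasoning
  _-ₚ_ : Poly → Poly → Poly
  p -ₚ q = p +ₚ - 1ℤ ·ₚ q
  f-g≡0 : ∀ x → eval (f -ₚ g) x ≡ 0ℤ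
  f-g≡0 x = begin
    eval (f -ₚ g) x                   ≡⟨ eval-+ₚ f _ x ⟩
    eval f x + eval (- 1ℤ ·ₚ g) x
      ≡⟨ cong (λ t → eval f x + t) (trans (eval-·ₚ (- 1ℤ) g x) (-1*i≡-i _)) ⟩
    eval f x - eval g x               ≡⟨ cong (_- eval g x) (f≗g x) ⟩
    eval g x - eval g x               ≡⟨ +-inverseʳ (eval g x) ⟩
    0ℤ                                ∎

-- The Euclidean algorithm over ℚ

-- Coefficient lists with the leading coefficient first, on which pseudo-division acts at the head.
evalʳ : List ℤ → ℤ → ℤ
evalʳ []      x = 0ℤ
evalʳ (c ∷ u) x = c * x ^ length u + evalʳ u x

evalʳ-++ : ∀ u v x → evalʳ (u ++ v) x ≡ evalʳ u x * x ^ length v + evalʳ v x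
evalʳ-++ []      v x = sym (+-identityˡ _)
evalʳ-++ (c ∷ u) v x = begin
  c * x ^ length (u ++ v) + evalʳ (u ++ v) x
    ≡⟨ cong₂ (λ s t → c * s + t) (trans (cong (x ^_) (length-++ u)) (^-distribˡ-+-* x (length u) (length v)))
                                 (evalʳ-++ u v x) ⟩
  c * (x ^ length u * x ^ length v) + (evalʳ u x * x ^ length v + evalʳ v x)
    ≡⟨ rearrange c (x ^ length u) (x ^ length v) (evalʳ u x) (evalʳ v x) ⟩
  (c * x ^ length u + evalʳ u x) * x ^ length v + evalʳ v x ∎
  where
  open ≡-Reasoning
  rearrange : ∀ c X Y U V → c * (X * Y) + (U * Y + V) ≡ (c * X + U) * Y + V
  rearrange = solve-∀

evalʳ-zeros : ∀ j x → evalʳ (replicate j 0ℤ) x ≡ 0ℤ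
evalʳ-zeros zero    x = refl
evalʳ-zeros (suc j) x = trans (+-identityˡ _) (evalʳ-zeros j x)

evalʳ-padded : ∀ u j x → evalʳ (u ++ replicate j 0ℤ) x ≡ evalʳ u x * x ^ j
evalʳ-padded u j x = begin
  evalʳ (u ++ replicate j 0ℤ) x                               ≡⟨ evalʳ-++ u (replicate j 0ℤ) x ⟩
  evalʳ u x * x ^ length (replicate j 0ℤ) + evalʳ (replicate j 0ℤ) x
    ≡⟨ cong₂ (λ s t → evalʳ u x * x ^ s + t) (length-replicate j) (evalʳ-zeros j x) ⟩
  evalʳ u x * x ^ j + 0ℤ                                      ≡⟨ +-identityʳ _ ⟩
  evalʳ u x * x ^ j                                           ∎
  where open ≡-Reasoning

evalʳ-reverse : ∀ f x → evalʳ (reverse f) x ≡ eval f x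
evalʳ-reverse []      x = refl
evalʳ-reverse (a ∷ f) x = begin
  evalʳ (reverse (a ∷ f)) x                    ≡⟨ cong (λ u → evalʳ u x) (unfold-reverse a f) ⟩
  evalʳ (reverse f ++ [ a ]) x                 ≡⟨ evalʳ-++ (reverse f) [ a ] x ⟩
  evalʳ (reverse f) x * (x * 1ℤ) + (a * 1ℤ + 0ℤ)
    ≡⟨ cong (λ t → t * (x * 1ℤ) + (a * 1ℤ + 0ℤ)) (evalʳ-reverse f x) ⟩
  eval f x * (x * 1ℤ) + (a * 1ℤ + 0ℤ)          ≡⟨ rearrange (eval f x) x a ⟩
  a + x * eval f x                             ∎
  where
  open ≡-Reasoning
  rearrange : ∀ F x a → F * (x * 1ℤ) + (a * 1ℤ + 0ℤ) ≡ a + x * F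
  rearrange = solve-∀

evalʳ-zipWith : ∀ b a u v x → length u ≡ length v →
                evalʳ (zipWith (λ s t → b * s - a * t) u v) x ≡ b * evalʳ u x - a * evalʳ v x
evalʳ-zipWith b a []      []      x _ = sym (cong₂ _-_ (*-zeroʳ b) (*-zeroʳ a))
evalʳ-zipWith b a (s ∷ u) (t ∷ v) x |u|≡|v| = begin
  (b * s - a * t) * x ^ length (zipWith _ u v) + evalʳ (zipWith _ u v) x
    ≡⟨ cong₂ (λ n r → (b * s - a * t) * x ^ n + r)
             (trans (length-zipWith _ u v) (trans (cong (_⊓ length v) |u|≡|v|′) (ℕₚ.⊓-idem (length v))))
             (evalʳ-zipWith b a u v x |u|≡|v|′) ⟩
  (b * s - a * t) * x ^ length v + (b * evalʳ u x - a * evalʳ v x)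
    ≡⟨ cong (λ n → (b * s - a * t) * x ^ n + (b * evalʳ u x - a * evalʳ v x)) (sym |u|≡|v|′) ⟩
  (b * s - a * t) * x ^ length u + (b * evalʳ u x - a * evalʳ v x)
    ≡⟨ rearrange b a s t (x ^ length u) (evalʳ u x) (evalʳ v x) ⟩
  b * (s * x ^ length u + evalʳ u x) - a * (t * x ^ length u + evalʳ v x)
    ≡⟨ cong (λ n → b * (s * x ^ length u + evalʳ u x) - a * (t * x ^ n + evalʳ v x)) |u|≡|v|′ ⟩
  b * (s * x ^ length u + evalʳ u x) - a * (t * x ^ length v + evalʳ v x) ∎
  where
  open ≡-Reasoning
  |u|≡|v|′ = ℕₚ.suc-injective |u|≡|v|
  rearrange : ∀ b a s t X U V → (b * s - a * t) * X + (b * U - a * V) ≡ b * (s * X + U) - a * (t * X + V)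
  rearrange = solve-∀

-- Divisibility in ℚ[x] with the denominators cleared.  The dividend is only given through its
-- values, so that it may be represented by a Poly or by a reversed coefficient list.
record _∣ℚ_ (g : Poly) (F : ℤ → ℤ) : Set where
  constructor dividesℚ
  field
    scale    : ℤ
    scale≢0  : scale ≢ 0ℤ
    cofactor : Poly
    equation : ∀ x → eval g x * eval cofactor x ≡ scale * F x

infix 4 _∣ℚ_

∣ℚ-respʳ : ∀ {g F F′} → F ≗ F′ → g ∣ℚ F → g ∣ℚ F′
∣ℚ-respʳ F≗F′ (dividesℚ m m≢0 h eq) = dividesℚ m m≢0 h (λ x → trans (eq x) (cong (m *_) (F≗F′ x)))

∣ℚ-trans : ∀ {g h F} → g ∣ℚ eval h → h ∣ℚ F → g ∣ℚ F
∣ℚ-trans {g} {h} {F} (dividesℚ m m≢0 u g∣h) (dividesℚ n n≢0 v h∣F) =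
  dividesℚ (m * n) (*-≢0 m≢0 n≢0) (u *ₚ v) λ x → begin
    eval g x * eval (u *ₚ v) x        ≡⟨ cong (eval g x *_) (eval-*ₚ u v x) ⟩
    eval g x * (eval u x * eval v x)  ≡⟨ sym (*-assoc (eval g x) _ _) ⟩
    eval g x * eval u x * eval v x    ≡⟨ cong (_* eval v x) (g∣h x) ⟩
    m * eval h x * eval v x           ≡⟨ *-assoc m _ _ ⟩
    m * (eval h x * eval v x)         ≡⟨ cong (m *_) (h∣F x) ⟩
    m * (n * F x)                     ≡⟨ sym (*-assoc m n (F x)) ⟩
    m * n * F x                       ∎
  where open ≡-Reasoning

0∣ℚ⇒≡0 : ∀ {g F} → (∀ x → eval g x ≡ 0ℤ) → g ∣ℚ F → ∀ x → F x ≡ 0ℤ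
0∣ℚ⇒≡0 {g} {F} g≡0 (dividesℚ m m≢0 h gh≡mF) x
  with i*j≡0⇒i≡0∨j≡0 m (trans (sym (gh≡mF x)) (cong (_* eval h x) (g≡0 x)))
... | inj₁ m≡0  = ⊥-elim (m≢0 m≡0)
... | inj₂ Fx≡0 = Fx≡0

∣ℚ-scalarˡ : ∀ {g g′ F} c → g ≈ₚ c ·ₚ g′ → g ∣ℚ F → g′ ∣ℚ F
∣ℚ-scalarˡ {g} {g′} {F} c g≈cg′ (dividesℚ m m≢0 h gh≡mF) = dividesℚ m m≢0 (c ·ₚ h) λ x → begin
  eval g′ x * eval (c ·ₚ h) x ≡⟨ cong (eval g′ x *_) (eval-·ₚ c h x) ⟩
  eval g′ x * (c * eval h x)  ≡⟨ rearrange (eval g′ x) c (eval h x) ⟩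
  c * eval g′ x * eval h x
    ≡⟨ cong (_* eval h x) (sym (trans (eval-cong {g} {c ·ₚ g′} g≈cg′ x) (eval-·ₚ c g′ x))) ⟩
  eval g x * eval h x         ≡⟨ gh≡mF x ⟩
  m * F x                     ∎
  where
  open ≡-Reasoning
  rearrange : ∀ a b d → a * (b * d) ≡ b * a * d
  rearrange = solve-∀

-- A common divisor in ℚ[x] of A and B which, like the gcd computed by the Euclidean algorithm,
-- lies in the ideal of ℤ[x] generated by A and B; we record only the consequence that its values
-- are divisible by every common divisor of the values of A and B.
record ℚGCD (A B : ℤ → ℤ) : Set where
  field
    divisor    : Poly
    divisor∣ℚA : divisor ∣ℚ A
    divisor∣ℚB : divisor ∣ℚ B
    greatest   : ∀ d x → d ∣ₛ A x → d ∣ₛ B x → d ∣ₛ eval divisor x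

ℚGCD-sym : ∀ {A B} → ℚGCD A B → ℚGCD B A
ℚGCD-sym G = record
  { divisor    = divisor
  ; divisor∣ℚA = divisor∣ℚB
  ; divisor∣ℚB = divisor∣ℚA
  ; greatest   = λ d x d∣B d∣A → greatest d x d∣A d∣B
  }
  where open ℚGCD G

ℚGCD-cong : ∀ {A A′ B B′} → A ≗ A′ → B ≗ B′ → ℚGCD A B → ℚGCD A′ B′
ℚGCD-cong A≗A′ B≗B′ G = record
  { divisor    = divisor
  ; divisor∣ℚA = ∣ℚ-respʳ A≗A′ divisor∣ℚA
  ; divisor∣ℚB = ∣ℚ-respʳ B≗B′ divisor∣ℚB
  ; greatest   = λ d x d∣A d∣B →
      greatest d x (subst (d ∣ₛ_) (sym (A≗A′ x)) d∣A) (subst (d ∣ₛ_) (sym (B≗B′ x)) d∣B)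
  }
  where open ℚGCD G

ℚGCD-zeroʳ : ∀ g → ℚGCD (eval g) (λ _ → 0ℤ)
ℚGCD-zeroʳ g = record
  { divisor    = g
  ; divisor∣ℚA = dividesℚ 1ℤ (λ ()) [ 1ℤ ] λ x → begin
      eval g x * (1ℤ + x * 0ℤ) ≡⟨ cong (λ t → eval g x * (1ℤ + t)) (*-zeroʳ x) ⟩
      eval g x * 1ℤ            ≡⟨ *-identityʳ _ ⟩
      eval g x                 ≡⟨ sym (*-identityˡ _) ⟩
      1ℤ * eval g x            ∎
  ; divisor∣ℚB = dividesℚ 1ℤ (λ ()) [] (λ x → *-zeroʳ (eval g x))
  ; greatest   = λ d x d∣g _ → d∣g
  }
  where open ≡-Reasoning

shift : ℕ → Poly → Poly
shift j h = replicate j 0ℤ ++ h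

eval-shift : ∀ j h x → eval (shift j h) x ≡ x ^ j * eval h x
eval-shift zero    h x = sym (*-identityˡ _)
eval-shift (suc j) h x = begin
  0ℤ + x * eval (shift j h) x ≡⟨ +-identityˡ _ ⟩
  x * eval (shift j h) x      ≡⟨ cong (x *_) (eval-shift j h x) ⟩
  x * (x ^ j * eval h x)      ≡⟨ sym (*-assoc x (x ^ j) (eval h x)) ⟩
  x * x ^ j * eval h x        ∎
  where open ≡-Reasoning

-- One pseudo-division step: A′ = b A - a xʲ B, with b ≠ 0, lies in the ideal of A and B and
-- conversely A is recovered from A′ and B over ℚ.
ℚGCD-pseudoRem : ∀ {A A′ B} b a j → b ≢ 0ℤ → (∀ x → A′ x ≡ b * A x - a * (x ^ j * B x)) →
                 ℚGCD A′ B → ℚGCD A B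
ℚGCD-pseudoRem {A} {A′} {B} b a j b≢0 A′≡ G = record
  { divisor    = divisor
  ; divisor∣ℚA = dividesℚ (m * n * b) (*-≢0 (*-≢0 m≢0 n≢0) b≢0) (n ·ₚ u +ₚ (m * a) ·ₚ shift j v) g∣A
  ; divisor∣ℚB = divisor∣ℚB
  ; greatest   = λ d x d∣A d∣B → greatest d x
      (subst (d ∣ₛ_) (sym (A′≡ x)) (∣m∣n⇒∣m-n (∣n⇒∣m*n b d∣A) (∣n⇒∣m*n a (∣n⇒∣m*n (x ^ j) d∣B))))
      d∣B
  }
  where
  open ℚGCD G
  open _∣ℚ_ divisor∣ℚA renaming (scale to m; scale≢0 to m≢0; cofactor to u; equation to gu≡mA′)
  open _∣ℚ_ divisor∣ℚB renaming (scale to n; scale≢0 to n≢0; cofactor to v; equation to gv≡nB)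
  open ≡-Reasoning
  expand : ∀ g u v m n a X → g * (n * u + m * a * (X * v)) ≡ n * (g * u) + m * a * X * (g * v)
  expand = solve-∀
  collect : ∀ m n b a X A B → n * (m * (b * A - a * (X * B))) + m * a * X * (n * B) ≡ m * n * b * A
  collect = solve-∀
  g∣A : ∀ x → eval divisor x * eval (n ·ₚ u +ₚ (m * a) ·ₚ shift j v) x ≡ m * n * b * A x
  g∣A x = begin
    eval divisor x * eval (n ·ₚ u +ₚ (m * a) ·ₚ shift j v) x
      ≡⟨ cong (eval divisor x *_) (trans (eval-+ₚ (n ·ₚ u) _ x) (cong₂ _+_ (eval-·ₚ n u x)
           (trans (eval-·ₚ (m * a) (shift j v) x) (cong (m * a *_) (eval-shift j v x))))) ⟩
    eval divisor x * (n * eval u x + m * a * (x ^ j * eval v x))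
      ≡⟨ expand (eval divisor x) (eval u x) (eval v x) m n a (x ^ j) ⟩
    n * (eval divisor x * eval u x) + m * a * x ^ j * (eval divisor x * eval v x)
      ≡⟨ cong₂ (λ s t → n * s + m * a * x ^ j * t)
               (trans (gu≡mA′ x) (cong (m *_) (A′≡ x))) (gv≡nB x) ⟩
    n * (m * (b * A x - a * (x ^ j * B x))) + m * a * x ^ j * (n * B x)
      ≡⟨ collect m n b a (x ^ j) (A x) (B x) ⟩
    m * n * b * A x ∎

-- b (a ∷ as) - a xᵐ⁻ⁿ (b ∷ bs) for lists of lengths m + 1 ≥ n + 1, with its vanishing leading
-- coefficient dropped.
pseudoRem : ℤ → List ℤ → ℤ → List ℤ → List ℤ
pseudoRem a as b bs = zipWith (λ s t → b * s - a * t) as (bs ++ replicate (length as ∸ length bs) 0ℤ)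

module _ (a : ℤ) (as : List ℤ) (b : ℤ) (bs : List ℤ) (bs≤as : length bs ≤ length as) where

  private
    j = length as ∸ length bs
    |as|≡|padded| : length as ≡ length (bs ++ replicate j 0ℤ)
    |as|≡|padded| = sym (trans (length-++ bs)
      (trans (cong (length bs ℕ.+_) (length-replicate j)) (ℕₚ.m+[n∸m]≡n bs≤as)))

  length-pseudoRem : length (pseudoRem a as b bs) ≡ length as
  length-pseudoRem =
    trans (length-zipWith _ as _) (trans (cong (length as ℕ.⊓_) (sym |as|≡|padded|)) (ℕₚ.⊓-idem _))

  evalʳ-pseudoRem : ∀ x →
    evalʳ (pseudoRem a as b bs) x ≡ b * evalʳ (a ∷ as) x - a * (x ^ j * evalʳ (b ∷ bs) x)
  evalʳ-pseudoRem x = begin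
    evalʳ (pseudoRem a as b bs) x
      ≡⟨ evalʳ-zipWith b a as _ x |as|≡|padded| ⟩
    b * evalʳ as x - a * evalʳ (bs ++ replicate j 0ℤ) x
      ≡⟨ cong (λ t → b * evalʳ as x - a * t) (evalʳ-padded bs j x) ⟩
    b * evalʳ as x - a * (evalʳ bs x * x ^ j)
      ≡⟨ rearrange b a (evalʳ as x) (evalʳ bs x) (x ^ length bs) (x ^ j) ⟩
    b * (a * (x ^ length bs * x ^ j) + evalʳ as x) - a * (x ^ j * (b * x ^ length bs + evalʳ bs x))
      ≡⟨ cong (λ t → b * (a * t + evalʳ as x) - a * (x ^ j * (b * x ^ length bs + evalʳ bs x)))
              (trans (sym (^-distribˡ-+-* x (length bs) j)) (cong (x ^_) (ℕₚ.m+[n∸m]≡n bs≤as))) ⟩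
    b * evalʳ (a ∷ as) x - a * (x ^ j * evalʳ (b ∷ bs) x) ∎
    where
    open ≡-Reasoning
    rearrange : ∀ b a U V P Q → b * U - a * (V * Q) ≡ b * (a * (P * Q) + U) - a * (Q * (b * P + V))
    rearrange = solve-∀

HeadNonzero : List ℤ → Set
HeadNonzero []      = ⊤
HeadNonzero (c ∷ _) = c ≢ 0ℤ

stripZeros : ∀ u → ∃[ r ] HeadNonzero r × length r ≤ length u × evalʳ r ≗ evalʳ u
stripZeros []      = [] , tt , z≤n , λ x → refl
stripZeros (c ∷ u) with c ≟ 0ℤ
... | no c≢0  = c ∷ u , c≢0 , ℕₚ.≤-refl , λ x → refl
... | yes refl with stripZeros u
...   | r , r₀≢0 , r≤u , r≗u =
  r , r₀≢0 , ℕₚ.m≤n⇒m≤1+n r≤u , λ x → trans (r≗u x) (sym (+-identityˡ _))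

eval-reverse : ∀ u x → eval (reverse u) x ≡ evalʳ u x
eval-reverse u x = trans (sym (evalʳ-reverse (reverse u) x)) (cong (λ v → evalʳ v x) (reverse-involutive u))

ℚgcdʳ : ∀ n u v → length u ℕ.+ length v ≤ n → ℚGCD (evalʳ u) (evalʳ v)
pseudoEuclid : ∀ n a b → HeadNonzero b → length b ≤ length a → length a ℕ.+ length b ≤ n →
               ℚGCD (evalʳ a) (evalʳ b)

ℚgcdʳ n u v |u|+|v|≤n with stripZeros u | stripZeros v
... | ru , ru₀≢0 , ru≤u , ru≗u | rv , rv₀≢0 , rv≤v , rv≗v with length rv ℕₚ.≤? length ru
...   | yes rv≤ru = ℚGCD-cong ru≗u rv≗v (pseudoEuclid n ru rv rv₀≢0 rv≤ru |ru|+|rv|≤n)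
  where
  |ru|+|rv|≤n = ℕₚ.≤-trans (ℕₚ.+-mono-≤ ru≤u rv≤v) |u|+|v|≤n
...   | no  rv≰ru =
  ℚGCD-cong ru≗u rv≗v (ℚGCD-sym (pseudoEuclid n rv ru ru₀≢0 (ℕₚ.<⇒≤ (ℕₚ.≰⇒> rv≰ru)) |rv|+|ru|≤n))
  where
  |rv|+|ru|≤n = ℕₚ.≤-trans (ℕₚ.≤-reflexive (ℕₚ.+-comm (length rv) _))
                           (ℕₚ.≤-trans (ℕₚ.+-mono-≤ ru≤u rv≤v) |u|+|v|≤n)

pseudoEuclid n       a        []       _   _ _ = ℚGCD-cong (eval-reverse a) (λ _ → refl) (ℚGCD-zeroʳ (reverse a))
pseudoEuclid n       []       (b ∷ bs) _   () _
pseudoEuclid zero    (a ∷ as) (b ∷ bs) _   _ ()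
pseudoEuclid (suc n) (a ∷ as) (b ∷ bs) b≢0 (s≤s bs≤as) (s≤s |as|+|b∷bs|≤n) =
  ℚGCD-pseudoRem b a (length as ∸ length bs) b≢0 (evalʳ-pseudoRem a as b bs bs≤as)
    (ℚgcdʳ n (pseudoRem a as b bs) (b ∷ bs)
      (subst (λ m → m ℕ.+ suc (length bs) ≤ n) (sym (length-pseudoRem a as b bs bs≤as)) |as|+|b∷bs|≤n))

ℚgcd₂ : ∀ f g → ℚGCD (eval f) (eval g)
ℚgcd₂ f g = ℚGCD-cong (evalʳ-reverse f) (evalʳ-reverse g) (ℚgcdʳ _ (reverse f) (reverse g) ℕₚ.≤-refl)

ℚgcd : ∀ k (f : Fin k → Poly) →
       ∃[ g ] (∀ i → g ∣ℚ eval (f i)) × (∀ d x → (∀ i → d ∣ₛ eval (f i) x) → d ∣ₛ eval g x)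
ℚgcd zero    f = [] , (λ ()) , λ d x _ → divides 0ℤ refl
ℚgcd (suc k) f with ℚgcd k (f ∘ suc)
... | g , g∣ℚf , greatest = G.divisor , G∣ℚf , G-greatest
  where
  module G = ℚGCD (ℚgcd₂ (f zero) g)
  G∣ℚf : ∀ i → G.divisor ∣ℚ eval (f i)
  G∣ℚf zero    = G.divisor∣ℚA
  G∣ℚf (suc i) = ∣ℚ-trans G.divisor∣ℚB (g∣ℚf i)
  G-greatest : ∀ d x → (∀ i → d ∣ₛ eval (f i) x) → d ∣ₛ eval G.divisor x
  G-greatest d x d∣f = G.greatest d x (d∣f zero) (greatest d x (d∣f ∘ suc))

-- Gauss's lemma

infix 4 _∣ᶜ_

_∣ᶜ_ : ℤ → Poly → Set
d ∣ᶜ f = ∀ n → d ∣ₛ coeff f n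

Primitive : Poly → Set
Primitive g = ∀ q → Prime q → ¬ (+ q ∣ᶜ g)

∣ᶜ⇒≈·ₚ : ∀ {d} h → d ∣ᶜ h → ∃[ h′ ] h ≈ₚ d ·ₚ h′
∣ᶜ⇒≈·ₚ {d} []      d∣h = [] , λ n → refl
∣ᶜ⇒≈·ₚ {d} (c ∷ h) d∣h with d∣h zero | ∣ᶜ⇒≈·ₚ h (d∣h ∘ suc)
... | divides t c≡td | h′ , h≈dh′ = t ∷ h′ , λ { zero → trans c≡td (*-comm t d) ; (suc n) → h≈dh′ n }

*ₚ-∷ʳ : ∀ g b h → g *ₚ (b ∷ h) ≈ₚ b ·ₚ g +ₚ (0ℤ ∷ g *ₚ h)
*ₚ-∷ʳ g b h = eval-injective (g *ₚ (b ∷ h)) (b ·ₚ g +ₚ (0ℤ ∷ g *ₚ h)) λ x → begin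
  eval (g *ₚ (b ∷ h)) x
    ≡⟨ eval-*ₚ g (b ∷ h) x ⟩
  eval g x * (b + x * eval h x)
    ≡⟨ rearrange (eval g x) b x (eval h x) ⟩
  b * eval g x + (0ℤ + x * (eval g x * eval h x))
    ≡⟨ sym (cong₂ (λ s t → s + (0ℤ + x * t)) (eval-·ₚ b g x) (eval-*ₚ g h x)) ⟩
  eval (b ·ₚ g) x + (0ℤ + x * eval (g *ₚ h) x)
    ≡⟨ sym (eval-+ₚ (b ·ₚ g) (0ℤ ∷ g *ₚ h) x) ⟩
  eval (b ·ₚ g +ₚ (0ℤ ∷ g *ₚ h)) x ∎
  where
  open ≡-Reasoning
  rearrange : ∀ G b x H → G * (b + x * H) ≡ b * G + (0ℤ + x * (G * H))
  rearrange = solve-∀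

coeff-∷*ₚ : ∀ a g h n → coeff ((a ∷ g) *ₚ h) (suc n) ≡ a * coeff h (suc n) + coeff (g *ₚ h) n
coeff-∷*ₚ a g h n =
  trans (coeff-+ₚ (a ·ₚ h) (0ℤ ∷ g *ₚ h) (suc n)) (cong (_+ coeff (g *ₚ h) n) (coeff-·ₚ a h (suc n)))

coeff-*ₚ∷ : ∀ g b h n → coeff (g *ₚ (b ∷ h)) (suc n) ≡ b * coeff g (suc n) + coeff (g *ₚ h) n
coeff-*ₚ∷ g b h n = trans (*ₚ-∷ʳ g b h (suc n))
  (trans (coeff-+ₚ (b ·ₚ g) (0ℤ ∷ g *ₚ h) (suc n)) (cong (_+ coeff (g *ₚ h) n) (coeff-·ₚ b g (suc n))))

∣ᶜ∷*⇒∣ᶜ : ∀ {q} a g h → Prime q → ¬ (+ q ∣ₛ a) → + q ∣ᶜ (a ∷ g) *ₚ h → + q ∣ᶜ h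
∣ᶜ∷*⇒∣ᶜ a g []      _  _   _        = λ _ → divides 0ℤ refl
∣ᶜ∷*⇒∣ᶜ {q} a g (b ∷ h) q-prime q∤a q∣g[bh] = λ { zero → q∣b ; (suc n) → q∣h n }
  where
  q∣b : + q ∣ₛ b
  q∣b = [ (λ q∣a → ⊥-elim (q∤a q∣a)) , (λ q∣b → q∣b) ]′
          (euclidsLemmaℤ a b q-prime (subst (+ q ∣ₛ_) (+-identityʳ (a * b)) (q∣g[bh] zero)))
  q∣gh : + q ∣ᶜ (a ∷ g) *ₚ h
  q∣gh n = ∣m+n∣m⇒∣n (subst (+ q ∣ₛ_) (coeff-*ₚ∷ (a ∷ g) b h n) (q∣g[bh] (suc n)))
                     (∣m⇒∣m*n (coeff (a ∷ g) (suc n)) q∣b)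
  q∣h : + q ∣ᶜ h
  q∣h = ∣ᶜ∷*⇒∣ᶜ a g h q-prime q∤a q∣gh

∣ᶜ*⇒∣ᶜ : ∀ {q} g h → Prime q → ¬ (+ q ∣ᶜ g) → + q ∣ᶜ g *ₚ h → + q ∣ᶜ h
∣ᶜ*⇒∣ᶜ []      h _  q∤g _ = ⊥-elim (q∤g (λ _ → divides 0ℤ refl))
∣ᶜ*⇒∣ᶜ {q} (a ∷ g) h q-prime q∤ag q∣agh with + q ∣ₛ? a
... | no  q∤a = ∣ᶜ∷*⇒∣ᶜ a g h q-prime q∤a q∣agh
... | yes q∣a = ∣ᶜ*⇒∣ᶜ g h q-prime q∤g q∣gh
  where
  q∤g : ¬ (+ q ∣ᶜ g)
  q∤g q∣g = q∤ag λ { zero → q∣a ; (suc n) → q∣g n }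
  q∣gh : + q ∣ᶜ g *ₚ h
  q∣gh n = ∣m+n∣m⇒∣n (subst (+ q ∣ₛ_) (coeff-∷*ₚ a g h n) (q∣agh (suc n)))
                     (∣m⇒∣m*n (coeff h (suc n)) q∣a)

gauss-product : ∀ g f → Primitive g → ∀ qs → All Prime qs → ∀ h →
                (∀ x → eval g x * eval h x ≡ + product qs * eval f x) →
                ∃[ h′ ] (∀ x → eval g x * eval h′ x ≡ eval f x)
gauss-product g f prim []       []       h gh≡f = h , λ x → trans (gh≡f x) (*-identityˡ _)
gauss-product g f prim (q ∷ qs) (q-prime ∷ qs-prime) h gh≡qPf =
  let h′ , h≈qh′ = ∣ᶜ⇒≈·ₚ h (∣ᶜ*⇒∣ᶜ g h q-prime (prim q q-prime) q∣gh)
  in gauss-product g f prim qs qs-prime h′ (gh′≡Pf h′ h≈qh′)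
  where
  open ≡-Reasoning
  P = product qs
  q∣gh : + q ∣ᶜ g *ₚ h
  q∣gh n = divides (+ P * coeff f n) (begin
    coeff (g *ₚ h) n
      ≡⟨ eval-injective (g *ₚ h) (+ (q ℕ.* P) ·ₚ f)
           (λ x → trans (eval-*ₚ g h x) (trans (gh≡qPf x) (sym (eval-·ₚ (+ (q ℕ.* P)) f x)))) n ⟩
    coeff (+ (q ℕ.* P) ·ₚ f) n ≡⟨ coeff-·ₚ (+ (q ℕ.* P)) f n ⟩
    + (q ℕ.* P) * coeff f n    ≡⟨ cong (_* coeff f n) (pos-* q P) ⟩
    + q * + P * coeff f n      ≡⟨ rotate (+ q) (+ P) (coeff f n) ⟩
    + P * coeff f n * + q      ∎)
    where
    rotate : ∀ a b c → a * b * c ≡ b * c * a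
    rotate = solve-∀
  instance
    q≢0 : ℤ.NonZero (+ q)
    q≢0 = ℤ.≢-nonZero λ q≡0 → ¬prime[0] (subst Prime (+-injective q≡0) q-prime)
  gh′≡Pf : ∀ h′ → h ≈ₚ + q ·ₚ h′ → ∀ x → eval g x * eval h′ x ≡ + P * eval f x
  gh′≡Pf h′ h≈qh′ x = *-cancelˡ-≡ (+ q) _ _ (begin
    + q * (eval g x * eval h′ x)  ≡⟨ swap (+ q) (eval g x) (eval h′ x) ⟩
    eval g x * (+ q * eval h′ x)
      ≡⟨ cong (eval g x *_) (sym (trans (eval-cong {h} {+ q ·ₚ h′} h≈qh′ x) (eval-·ₚ (+ q) h′ x))) ⟩
    eval g x * eval h x           ≡⟨ gh≡qPf x ⟩
    + (q ℕ.* P) * eval f x        ≡⟨ cong (_* eval f x) (pos-* q P) ⟩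
    + q * + P * eval f x          ≡⟨ *-assoc (+ q) _ _ ⟩
    + q * (+ P * eval f x)        ∎)
    where
    swap : ∀ a b c → a * (b * c) ≡ b * (a * c)
    swap = solve-∀

cofactor-abs : ∀ g m h (F : ℤ → ℤ) → (∀ x → eval g x * eval h x ≡ m * F x) →
               ∃[ h′ ] (∀ x → eval g x * eval h′ x ≡ + ∣ m ∣ * F x)
cofactor-abs g (+ n)    h F gh≡mF = h , gh≡mF
cofactor-abs g -[1+ n ] h F gh≡mF = - 1ℤ ·ₚ h , λ x → begin
  eval g x * eval (- 1ℤ ·ₚ h) x  ≡⟨ cong (eval g x *_) (eval-·ₚ (- 1ℤ) h x) ⟩
  eval g x * (- 1ℤ * eval h x)   ≡⟨ rearrange (eval g x) (eval h x) ⟩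
  - 1ℤ * (eval g x * eval h x)   ≡⟨ cong (- 1ℤ *_) (gh≡mF x) ⟩
  - 1ℤ * (-[1+ n ] * F x)        ≡⟨ sym (*-assoc (- 1ℤ) -[1+ n ] (F x)) ⟩
  - 1ℤ * -[1+ n ] * F x          ≡⟨ cong (_* F x) (-1*i≡-i -[1+ n ]) ⟩
  + suc n * F x                  ∎
  where
  open ≡-Reasoning
  rearrange : ∀ a b → a * (- 1ℤ * b) ≡ - 1ℤ * (a * b)
  rearrange = solve-∀

gauss : ∀ {g f} → Primitive g → g ∣ℚ eval f → g ∣ₚ f
gauss {g} {f} prim (dividesℚ m m≢0 h gh≡mf) =
  let h₁ , gh₁≡∣m∣f = cofactor-abs g m h (eval f) gh≡mf
      h′ , gh′≡f = gauss-product g f prim factors factorsPrime h₁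
                     (λ x → trans (gh₁≡∣m∣f x) (cong (λ t → + t * eval f x) isFactorisation))
  in h′ , eval-injective (g *ₚ h′) f (λ x → trans (eval-*ₚ g h′ x) (gh′≡f x))
  where
  instance
    ∣m∣≢0 : ℕ.NonZero ∣ m ∣
    ∣m∣≢0 = ℕ.≢-nonZero (m≢0 ∘ ∣i∣≡0⇒i≡0)
  open PrimeFactorisation (factorise ∣ m ∣)

content : Poly → ℤ
content []      = 0ℤ
content (a ∷ f) = gcd a (content f)

content∣coeff : ∀ f n → content f ∣ coeff f n
content∣coeff []      n       = ∣ 0ℤ ∣ ℕᵈ.∣0
content∣coeff (a ∷ f) zero    = gcd[i,j]∣i a (content f)
content∣coeff (a ∷ f) (suc n) = ℕᵈ.∣-trans (gcd[i,j]∣j a (content f)) (content∣coeff f n)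

∣coeff⇒∣content : ∀ {d} f → (∀ n → d ∣ coeff f n) → d ∣ content f
∣coeff⇒∣content {d} []      _   = ∣ d ∣ ℕᵈ.∣0
∣coeff⇒∣content {d} (a ∷ f) d∣f =
  gcd-greatest {a} {content f} {d} (d∣f zero) (∣coeff⇒∣content {d} f (d∣f ∘ suc))

content≡0⇒eval≡0 : ∀ f → content f ≡ 0ℤ → ∀ x → eval f x ≡ 0ℤ
content≡0⇒eval≡0 f c≡0 = eval-zero f λ n →
  ∣i∣≡0⇒i≡0 (ℕᵈ.0∣⇒≡0 (subst (_∣ coeff f n) c≡0 (content∣coeff f n)))

primitivePart : ∀ f → content f ≢ 0ℤ → ∃[ f′ ] f ≈ₚ content f ·ₚ f′ × Primitive f′
primitivePart f c≢0 with ∣ᶜ⇒≈·ₚ f (∣ᵤ⇒∣ {content f} ∘ content∣coeff f)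
... | f′ , f≈cf′ = f′ , f≈cf′ , f′-primitive
  where
  c = content f
  instance
    ∣c∣≢0 : ℕ.NonZero ∣ c ∣
    ∣c∣≢0 = ℕ.≢-nonZero (c≢0 ∘ ∣i∣≡0⇒i≡0)
  f′-primitive : Primitive f′
  f′-primitive q q-prime q∣f′ = ¬prime[1] (subst Prime (ℕᵈ.∣1⇒≡1 q∣1) q-prime)
    where
    cq∣f : ∀ n → c * + q ∣ coeff f n
    cq∣f n = ∣⇒∣ᵤ {c * + q} (subst (c * + q ∣ₛ_) (sym (trans (f≈cf′ n) (coeff-·ₚ c f′ n)))
                                  (*-monoʳ-∣ c (q∣f′ n)))
    q∣1 : q ℕᵈ.∣ 1
    q∣1 = ℕᵈ.*-cancelˡ-∣ ∣ c ∣ (subst₂ ℕᵈ._∣_ (abs-* c (+ q)) (sym (ℕₚ.*-identityʳ ∣ c ∣))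
                                      (∣coeff⇒∣content {c * + q} f cq∣f))

-- Large primes

∣ₚ1⇒unit : ∀ g → g ∣ₚ [ 1ℤ ] → ∃[ u ] (∀ x → eval g x * eval u x ≡ 1ℤ)
∣ₚ1⇒unit g (u , gu≈1) = u , λ x → begin
  eval g x * eval u x   ≡⟨ sym (eval-*ₚ g u x) ⟩
  eval (g *ₚ u) x       ≡⟨ eval-cong {g *ₚ u} {[ 1ℤ ]} gu≈1 x ⟩
  1ℤ + x * 0ℤ           ≡⟨ cong (λ t → 1ℤ + t) (*-zeroʳ x) ⟩
  1ℤ                    ∎
  where open ≡-Reasoning

scaled-unit : ∀ {g g′ u} c → g ≈ₚ c ·ₚ g′ → (∀ x → eval g′ x * eval u x ≡ 1ℤ) →
              ∀ x → eval g x * eval u x ≡ c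
scaled-unit {g} {g′} {u} c g≈cg′ g′u≡1 x = begin
  eval g x * eval u x         ≡⟨ cong (_* eval u x) (trans (eval-cong {g} {c ·ₚ g′} g≈cg′ x) (eval-·ₚ c g′ x)) ⟩
  c * eval g′ x * eval u x    ≡⟨ *-assoc c _ _ ⟩
  c * (eval g′ x * eval u x)  ≡⟨ cong (c *_) (g′u≡1 x) ⟩
  c * 1ℤ                      ≡⟨ *-identityʳ c ⟩
  c                           ∎
  where open ≡-Reasoning

module _ {k} (f : Fin k → Poly) (gcd1 : GcdOne f) where

  GcdOne⇒¬zero : ¬ (∀ i x → eval (f i) x ≡ 0ℤ)
  GcdOne⇒¬zero f≡0 =
    let u , 2u≡1 = ∣ₚ1⇒unit [ + 2 ] (gcd1 [ + 2 ] 2∣f)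
    in 2*i≢1 (eval u 0ℤ) (2u≡1 0ℤ)
    where
    2∣f : ∀ i → [ + 2 ] ∣ₚ f i
    2∣f i = [] , eval-injective ([ + 2 ] *ₚ []) (f i) λ x →
      trans (eval-*ₚ [ + 2 ] [] x) (trans (*-zeroʳ (eval [ + 2 ] x)) (sym (f≡0 i x)))

  GcdOne⇒content≢0 : ∀ {g} → (∀ i → g ∣ℚ eval (f i)) → content g ≢ 0ℤ
  GcdOne⇒content≢0 {g} g∣ℚf c≡0 = GcdOne⇒¬zero λ i → 0∣ℚ⇒≡0 (content≡0⇒eval≡0 g c≡0) (g∣ℚf i)

  GcdOne⇒primitive-unit : ∀ {g} → Primitive g → (∀ i → g ∣ℚ eval (f i)) →
                          ∃[ u ] (∀ x → eval g x * eval u x ≡ 1ℤ)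
  GcdOne⇒primitive-unit {g} g-primitive g∣ℚf =
    ∣ₚ1⇒unit g (gcd1 g λ i → gauss {g} {f i} g-primitive (g∣ℚf i))

  -- Gauss's lemma turns a common divisor of the fᵢ over ℚ into its content times a unit of ℤ[x].
  ℚ-common-divisor-constant : ∀ {g} → (∀ i → g ∣ℚ eval (f i)) →
                              ∃[ u ] (∀ x → eval g x * eval u x ≡ content g)
  ℚ-common-divisor-constant {g} g∣ℚf =
    let g′ , g≈cg′ , g′-primitive = primitivePart g (GcdOne⇒content≢0 g∣ℚf)
        u , g′u≡1 = GcdOne⇒primitive-unit g′-primitive
                      (λ i → ∣ℚ-scalarˡ {g} {g′} (content g) g≈cg′ (g∣ℚf i))
    in u , scaled-unit {g} {g′} {u} (content g) g≈cg′ g′u≡1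

  eventually-no-common-root : ∃[ N ] (∀ p → Prime p → N < p → ∀ x → ¬ (∀ i → + p ∣ₛ eval (f i) x))
  eventually-no-common-root =
    let g , g∣ℚf , greatest = ℚgcd k f
        u , gu≡c = ℚ-common-divisor-constant g∣ℚf
        p∣c : ∀ p x → (∀ i → + p ∣ₛ eval (f i) x) → + p ∣ₛ content g
        p∣c p x p∣f = subst (+ p ∣ₛ_) (gu≡c x) (∣m⇒∣m*n (eval u x) (greatest (+ p) x p∣f))
    in ∣ content g ∣ , λ p _ ∣c∣<p x p∣f →
         GcdOne⇒content≢0 g∣ℚf (∣n∣<d∧d∣n⇒n≡0 ∣c∣<p (p∣c p x p∣f))

-- Choosing the coefficients modulo p

dot : ∀ {k} → (Fin k → ℤ) → (Fin k → ℤ) → ℤ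
dot {zero}  c w = 0ℤ
dot {suc k} c w = c zero * w zero + dot (c ∘ suc) (w ∘ suc)

eval-linComb : ∀ k c f x → eval (linComb k c f) x ≡ dot c (λ i → eval (f i) x)
eval-linComb zero    c f x = refl
eval-linComb (suc k) c f x = trans (eval-+ₚ (c zero ·ₚ f zero) (linComb k (c ∘ suc) (f ∘ suc)) x)
  (cong₂ _+_ (eval-·ₚ (c zero) (f zero) x) (eval-linComb k (c ∘ suc) (f ∘ suc) x))

merge : ∀ {k} → ℤ → ℤ → (Fin (suc (suc k)) → ℤ) → Fin (suc k) → ℤ
merge s t w zero    = s * w zero + t * w (suc zero)
merge s t w (suc i) = w (suc (suc i))

spread : ∀ {k} → (Fin (suc k) → ℤ) → ℤ → ℤ → Fin (suc (suc k)) → ℤ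
spread c s t zero          = c zero * s
spread c s t (suc zero)    = c zero * t
spread c s t (suc (suc i)) = c (suc i)

dot-spread : ∀ {k} (c : Fin (suc k) → ℤ) s t w → dot (spread c s t) w ≡ dot c (merge s t w)
dot-spread c s t w = regroup (c zero) s t (w zero) (w (suc zero)) (dot (c ∘ suc) (λ i → w (suc (suc i))))
  where
  regroup : ∀ c s t w₀ w₁ r → c * s * w₀ + (c * t * w₁ + r) ≡ c * (s * w₀ + t * w₁) + r
  regroup = solve-∀

toℕ-∣-injective : ∀ {p} (t t′ : Fin p) → + p ∣ₛ + toℕ t - + toℕ t′ → t ≡ t′
toℕ-∣-injective {p} t t′ p∣t-t′ =
  Finₚ.toℕ-injective (+-injective (i-j≡0⇒i≡j _ _ (∣n∣<d∧d∣n⇒n≡0 ∣t-t′∣<p p∣t-t′)))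
  where
  ∣t-t′∣<p : ∣ + toℕ t - + toℕ t′ ∣ < p
  ∣t-t′∣<p = ℕₚ.≤-<-trans (ℕₚ.≤-reflexive (cong ∣_∣ (m-n≡m⊖n (toℕ t) (toℕ t′))))
               (ℕₚ.≤-<-trans (∣m⊝n∣≤m⊔n (toℕ t) (toℕ t′)) (ℕₚ.⊔-pres-<m (Finₚ.toℕ<n t) (Finₚ.toℕ<n t′)))

-- The p + 1 pairs (0, 1) and (1, t), t < p, are pairwise independent mod p, so a vector
-- (u, v) ≢ 0 mod p is orthogonal to at most one of them; n ≤ p vectors leave one pair free.
module _ {p n} (p-prime : Prime p) (n≤p : n ≤ p) (u v : Fin n → ℤ) where

  private
    coef₀ coef₁ : Fin (suc p) → ℤ
    coef₀ zero    = 0ℤ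
    coef₀ (suc t) = 1ℤ
    coef₁ zero    = 1ℤ
    coef₁ (suc t) = + toℕ t

    Kills : Fin (suc p) → Fin n → Set
    Kills i a = + p ∣ₛ coef₀ i * u a + coef₁ i * v a

    Zero : Fin n → Set
    Zero a = + p ∣ₛ u a × + p ∣ₛ v a

    Safe? : ∀ i a → Dec (Kills i a → Zero a)
    Safe? i a = (+ p ∣ₛ? _) →-dec (+ p ∣ₛ? u a) ×-dec (+ p ∣ₛ? v a)

    kills-zero⇒∣v : ∀ {a} → Kills zero a → + p ∣ₛ v a
    kills-zero⇒∣v {a} = subst (+ p ∣ₛ_) (trans (+-identityˡ _) (*-identityˡ (v a)))

    kills-suc⇒∣u : ∀ {a} t → Kills (suc t) a → + p ∣ₛ v a → + p ∣ₛ u a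
    kills-suc⇒∣u {a} t kills p∣v =
      ∣m+n∣n⇒∣m (subst (+ p ∣ₛ_) (cong (_+ + toℕ t * v a) (*-identityˡ (u a))) kills)
                (∣n⇒∣m*n (+ toℕ t) p∣v)

    at-most-one : ∀ {a} i j → Kills i a → Kills j a → ¬ Zero a → i ≡ j
    at-most-one zero    zero     _  _  _  = refl
    at-most-one zero    (suc t)  k₀ k₁ ¬z = ⊥-elim (¬z (kills-suc⇒∣u t k₁ p∣v , p∣v))
      where p∣v = kills-zero⇒∣v k₀
    at-most-one (suc t) zero     k₁ k₀ ¬z = ⊥-elim (¬z (kills-suc⇒∣u t k₁ p∣v , p∣v))
      where p∣v = kills-zero⇒∣v k₀
    at-most-one {a} (suc t) (suc t′) k k′ ¬z
      with euclidsLemmaℤ (+ toℕ t - + toℕ t′) (v a) p-prime p∣[t-t′]v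
      where
      difference : ∀ U V T T′ → 1ℤ * U + T * V - (1ℤ * U + T′ * V) ≡ (T - T′) * V
      difference = solve-∀
      p∣[t-t′]v = subst (+ p ∣ₛ_) (difference (u a) (v a) (+ toℕ t) (+ toℕ t′)) (∣m∣n⇒∣m-n k k′)
    ... | inj₁ p∣t-t′ = cong suc (toℕ-∣-injective t t′ p∣t-t′)
    ... | inj₂ p∣v    = ⊥-elim (¬z (kills-suc⇒∣u t k p∣v , p∣v))

  outside-hyperplanes₂ : ∃₂ λ s t → ∀ a → + p ∣ₛ s * u a + t * v a → + p ∣ₛ u a × + p ∣ₛ v a
  outside-hyperplanes₂ with Finₚ.any? (λ i → Finₚ.all? (Safe? i))
  ... | yes (i , safe) = coef₀ i , coef₁ i , safe
  ... | no  none-safe  =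
    let i , j , i<j , same = Finₚ.pigeonhole (s≤s n≤p) (λ i → proj₁ (killer i))
        _ , kills-i , _     = killer i
        _ , kills-j , ¬zero = killer j
    in ⊥-elim (Finₚ.<⇒≢ i<j (at-most-one i j (subst (Kills i) same kills-i) kills-j ¬zero))
    where
    killer : ∀ i → ∃[ a ] Kills i a × ¬ Zero a
    killer i with Finₚ.¬∀⟶∃¬ n _ (Safe? i) (λ safe → none-safe (i , safe))
    ... | a , ¬safe =
      a , decidable-stable (+ p ∣ₛ? _) (λ ¬kills → ¬safe (⊥-elim ∘ ¬kills)) , λ z → ¬safe (λ _ → z)

merge-≢0 : ∀ {p n k} s t (w : Fin n → Fin (suc (suc k)) → ℤ) →
           (∀ a → + p ∣ₛ s * w a zero + t * w a (suc zero) → + p ∣ₛ w a zero × + p ∣ₛ w a (suc zero)) →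
           (∀ a → ¬ (∀ i → + p ∣ₛ w a i)) → ∀ a → ¬ (∀ i → + p ∣ₛ merge s t (w a) i)
merge-≢0 s t w merged≡0⇒≡0 w≢0 a p∣merge = w≢0 a λ where
  zero          → proj₁ (merged≡0⇒≡0 a (p∣merge zero))
  (suc zero)    → proj₂ (merged≡0⇒≡0 a (p∣merge zero))
  (suc (suc i)) → p∣merge (suc i)

outside-hyperplanes : ∀ {p n} → Prime p → n ≤ p → ∀ k (w : Fin n → Fin k → ℤ) →
                      (∀ a → ¬ (∀ i → + p ∣ₛ w a i)) → ∃[ c ] (∀ a → ¬ (+ p ∣ₛ dot c (w a)))
outside-hyperplanes     p-prime n≤p zero          w w≢0 = (λ ()) , λ a _ → w≢0 a (λ ())
outside-hyperplanes {p} p-prime n≤p (suc zero)    w w≢0 = (λ _ → 1ℤ) , λ a p∣w₀ →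
  w≢0 a λ { zero → subst (+ p ∣ₛ_) (trans (+-identityʳ _) (*-identityˡ _)) p∣w₀ }
outside-hyperplanes {p} p-prime n≤p (suc (suc k)) w w≢0 =
  let s , t , merged≡0⇒≡0 = outside-hyperplanes₂ p-prime n≤p (λ a → w a zero) (λ a → w a (suc zero))
      c , c-good = outside-hyperplanes p-prime n≤p (suc k) (merge s t ∘ w) (merge-≢0 s t w merged≡0⇒≡0 w≢0)
  in spread c s t , λ a p∣dot → c-good a (subst (+ p ∣ₛ_) (dot-spread c s t (w a)) p∣dot)

residue : ∀ p .{{_ : ℕ.NonZero p}} x → ∃[ a ] (+ p ∣ₛ x - + toℕ {p} a)
residue p x = fromℕ< (n%ℕd<d x p) , divides (x /ℕ p) (begin
  x - + toℕ (fromℕ< (n%ℕd<d x p))     ≡⟨ cong (λ r → x - + r) (Finₚ.toℕ-fromℕ< (n%ℕd<d x p)) ⟩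
  x - + (x %ℕ p)                      ≡⟨ cong (_- + (x %ℕ p)) (a≡a%ℕn+[a/ℕn]*n x p) ⟩
  + (x %ℕ p) + x /ℕ p * + p - + (x %ℕ p) ≡⟨ cancel (+ (x %ℕ p)) (x /ℕ p * + p) ⟩
  x /ℕ p * + p                        ∎)
  where
  open ≡-Reasoning
  cancel : ∀ r q → r + q - r ≡ q
  cancel = solve-∀

∣-eval-cong : ∀ {d} f x y → d ∣ₛ x - y → d ∣ₛ eval f x → d ∣ₛ eval f y
∣-eval-cong {d} f x y d∣x-y d∣fx = subst (d ∣ₛ_) (cancel (eval f x) (eval f y))
  (∣m∣n⇒∣m-n d∣fx (∣-trans d∣x-y (x-y∣f[x]-f[y] f x y)))
  where
  cancel : ∀ a b → a - (a - b) ≡ b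
  cancel = solve-∀

rootless-combination : ∀ {p} k (f : Fin k → Poly) → Prime p → (∀ x → ¬ (∀ i → + p ∣ₛ eval (f i) x)) →
                       ∃[ c ] (∀ x → ¬ (+ p ∣ₛ eval (linComb k c f) x))
rootless-combination {p} k f p-prime no-root =
  let c , c-good = outside-hyperplanes p-prime ℕₚ.≤-refl k (λ a i → eval (f i) (+ toℕ a)) (no-root ∘ +_ ∘ toℕ)
  in c , λ x p∣Lx →
    let a , p∣x-a = residue p ⦃ prime⇒nonZero p-prime ⦄ x
        p∣La = ∣-eval-cong (linComb k c f) x (+ toℕ a) p∣x-a p∣Lx
    in c-good a (subst (+ p ∣ₛ_) (eval-linComb k c f (+ toℕ a)) p∣La)

lemma1 : (k : ℕ) → 1 < k → (f : Fin k → Poly) → GcdOne f →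
         ∃[ N ] (∀ (p : ℕ) → Prime p → N < p →
           ∃[ c ] (∀ (a : ℤ) → ¬ ((+ p) ∣ eval (linComb k c f) a)))
lemma1 k _ f gcd1 =
  let N , no-root = eventually-no-common-root f gcd1
  in N , λ p p-prime N<p →
    let c , rootless = rootless-combination k f p-prime (no-root p p-prime N<p)
    in c , λ a p∣La → rootless a (∣ᵤ⇒∣ p∣La)
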